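{- For every positive integer $n$, $\mathrm{sat}^*(n,2C_3)\le 3n-1$.
   Context: $2C_3$ is the poset consisting of two disjoint 3-element chains with no relations between them. A subfamily $\mathcal G\subseteq\mathcal F\subseteq 2^{[n]}$ is an induced copy of a poset $P$ if there is a bijection $i:P\to\mathcal G$ with $p\le_P q$ iff $i(p)\subseteq i(q)$; $\mathcal F$ is induced $P$-saturating if it has no induced copy of $P$ and adding any $G\in2^{[n]}\setminus\mathcal F$ creates one. $\mathrm{sat}^*(n,P)$ is the minimum size of an induced $P$-saturating family in $2^{[n]}$. -}

module Defs where

open import Data.Nat using (ℕ)
open import Data.Fin using (Fin)
open import Data.Fin.Subset using (Subset; _⊆_)
open import Data.Product using (_×_; Σ-syntax; proj₁; proj₂)
open import Data.List using (List; _∷_)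
open import Data.List.Membership.Propositional using (_∈_)
open import Relation.Binary.PropositionalEquality using (_≡_)
open import Relation.Nullary using (¬_)
open import Function.Bundles using (_⇔_)
open import Function.Definitions using (Injective)
import Data.Fin as F

-- The poset 2C_3: ground set Fin 2 × Fin 3 (chain index, position in chain),
-- (c , i) ≤ (d , j)  iff  c ≡ d and i ≤ j.
2C₃ : Set
2C₃ = Fin 2 × Fin 3

_≤2C₃_ : 2C₃ → 2C₃ → Set
p ≤2C₃ q = (proj₁ p ≡ proj₁ q) × (proj₂ p F.≤ proj₂ q)

-- A family of subsets of [n] is represented as a list of subsets (without duplicates
-- where relevant); membership is list membership.
Family : ℕ → Set
Family n = List (Subset n)

InducedCopy2C₃ : {n : ℕ} → Family n → Set
InducedCopy2C₃ {n} 𝓕 =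
  Σ[ i ∈ (2C₃ → Subset n) ]
    ( Injective _≡_ _≡_ i
    × (∀ p → i p ∈ 𝓕)
    × (∀ p q → (p ≤2C₃ q) ⇔ (i p ⊆ i q)) )

InducedSaturating2C₃ : {n : ℕ} → Family n → Set
InducedSaturating2C₃ {n} 𝓕 =
  ¬ InducedCopy2C₃ 𝓕
  × (∀ (G : Subset n) → ¬ (G ∈ 𝓕) → InducedCopy2C₃ (G ∷ 𝓕))

-- Call a subset of [n] tame if it is ∅, [n], a singleton, the complement of a
-- singleton, or an initial segment {0, …, k-1} with 1 < k < n-1; for n ≥ 3
-- there are exactly 3n-1 tame sets, and they form the saturating family.
-- In an induced 2C₃ no bottom element is empty and no top element is [n]
-- (either would be comparable with the other chain), so a middle element is
-- neither ∅, [n], a singleton nor a cosingleton. Among tame sets both middle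
-- elements would thus be initial segments, which are comparable.
-- Conversely a non-tame G has a size s with 1 < s < n-1 and differs from the
-- tame segment S of size s; for a ∈ S∖G and b ∈ G∖S the chains
-- {a} ⊂ S ⊂ [n]∖{b} and {b} ⊂ G ⊂ [n]∖{a} form an induced 2C₃.
module Submission where

open import Defs
open import Data.Nat using (ℕ; zero; suc; _≤_; _<_; _*_; _∸_; _+_; z≤n; s≤s; _≤?_)
open import Data.Nat.Properties
  using (≤-refl; ≤-reflexive; ≤-trans; <-trans; ≤-total; <⇒≤; <⇒≱; <⇒≢; ≰⇒>; n≤1+n; m≤n⇒m≤1+n)
open import Data.Nat.Tactic.RingSolver using (solve-∀)
open import Data.Fin as F using (Fin; zero; suc)
open import Data.Fin.Properties using (_≟_; any?; ≤fromℕ; ≤-antisym)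
open import Data.Fin.Subset
open import Data.Fin.Subset.Properties
open import Data.Vec using ([]; _∷_)
open import Data.Product using (_×_; _,_; proj₁; proj₂; ∃; Σ-syntax)
open import Data.Empty using (⊥-elim)
open import Data.Sum as Sum using (_⊎_; inj₁; inj₂)
open import Data.List using (List; []; _∷_; _++_; map; allFin; applyUpTo; length)
open import Data.List.Properties using (length-++; length-map; length-tabulate; length-applyUpTo)
import Data.List.Membership.Propositional as List
open import Data.List.Membership.Propositional.Properties
  using (∈-map⁺; ∈-++⁺ˡ; ∈-++⁺ʳ; ∈-applyUpTo⁺; ∈-allFin)
open import Data.List.Relation.Unary.Any using (here; there)
open import Data.List.Relation.Unary.All as All using (All; []; _∷_)
import Data.List.Relation.Unary.All.Properties as All
open import Data.List.Relation.Unary.AllPairs using ([]; _∷_)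
open import Data.List.Relation.Unary.Unique.Propositional using (Unique)
import Data.List.Relation.Unary.Unique.Propositional.Properties as Unique
open import Function using (_∘_; id)
open import Function.Bundles using (_⇔_; mk⇔; Equivalence)
open import Function.Definitions using (Injective)
open import Relation.Binary.PropositionalEquality
  using (_≡_; _≢_; refl; sym; trans; cong; cong₂; subst; subst₂; module ≡-Reasoning)
open import Relation.Nullary using (¬_; yes; no; contradiction; ¬?)
open import Relation.Nullary.Decidable using (_×-dec_; decidable-stable)

open Equivalence using (to; from)

pattern left  = zero
pattern right = suc zero

pattern bot = zero
pattern mid = suc zero
pattern top = suc (suc zero)

private
  variable
    n : ℕ
    p q r : Subset n
    x : Fin n

p⊈q⇒∃x∈p∧x∉q : p ⊈ q → ∃ λ x → x ∈ p × x ∉ q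
p⊈q⇒∃x∈p∧x∉q {p = p} {q} p⊈q with any? (λ x → x ∈? p ×-dec ¬? (x ∈? q))
... | yes witness = witness
... | no none =
  contradiction (λ {x} x∈p → decidable-stable (x ∈? q) (λ x∉q → none (x , x∈p , x∉q))) p⊈q

p⊆q∧∣q∣≤∣p∣⇒p≡q : p ⊆ q → ∣ q ∣ ≤ ∣ p ∣ → p ≡ q
p⊆q∧∣q∣≤∣p∣⇒p≡q {p = p} {q} p⊆q ∣q∣≤∣p∣ with q ⊆? p
... | yes q⊆p = ⊆-antisym p⊆q q⊆p
... | no q⊈p =
  contradiction ∣q∣≤∣p∣ (<⇒≱ (p⊂q⇒∣p∣<∣q∣ (p⊆q , p⊈q⇒∃x∈p∧x∉q q⊈p)))

∣p∣≡∣q∣∧p≢q⇒p⊈q : ∣ p ∣ ≡ ∣ q ∣ → p ≢ q → p ⊈ q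
∣p∣≡∣q∣∧p≢q⇒p⊈q ∣p∣≡∣q∣ p≢q p⊆q = p≢q (p⊆q∧∣q∣≤∣p∣⇒p≡q p⊆q (≤-reflexive (sym ∣p∣≡∣q∣)))

∣p∣<∣q∣⇒q⊈p : ∣ p ∣ < ∣ q ∣ → q ⊈ p
∣p∣<∣q∣⇒q⊈p ∣p∣<∣q∣ q⊆p = <⇒≱ ∣p∣<∣q∣ (p⊆q⇒∣p∣≤∣q∣ q⊆p)

x∈p⇒⁅x⁆⊆p : x ∈ p → ⁅ x ⁆ ⊆ p
x∈p⇒⁅x⁆⊆p {x = x} {p} x∈p y∈⁅x⁆ = subst (_∈ p) (sym (x∈⁅y⁆⇒x≡y x y∈⁅x⁆)) x∈p

x≢y⇒x∈∁⁅y⁆ : {x y : Fin n} → x ≢ y → x ∈ ∁ ⁅ y ⁆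
x≢y⇒x∈∁⁅y⁆ x≢y = x∉p⇒x∈∁p (x≢y⇒x∉⁅y⁆ x≢y)

x∉p⇒p⊆∁⁅x⁆ : x ∉ p → p ⊆ ∁ ⁅ x ⁆
x∉p⇒p⊆∁⁅x⁆ x∉p y∈p = x≢y⇒x∈∁⁅y⁆ (λ { refl → x∉p y∈p })

∣∁⁅x⁆∣≡n∸1 : (x : Fin n) → ∣ ∁ ⁅ x ⁆ ∣ ≡ n ∸ 1
∣∁⁅x⁆∣≡n∸1 {n} x = trans (∣∁p∣≡n∸∣p∣ ⁅ x ⁆) (cong (n ∸_) (∣⁅x⁆∣≡1 x))

⁅⁆-injective : Injective _≡_ _≡_ (⁅_⁆ {n})
⁅⁆-injective {x = x} {y} ⁅x⁆≡⁅y⁆ = x∈⁅y⁆⇒x≡y y (subst (x ∈_) ⁅x⁆≡⁅y⁆ (x∈⁅x⁆ x))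

∁⁅⁆-injective : Injective _≡_ _≡_ (∁ ∘ ⁅_⁆ {n})
∁⁅⁆-injective {x = x} {y} e = x∈⁅y⁆⇒x≡y y (∁p⊆∁q⇒p⊇q (⊆-reflexive (sym e)) (x∈⁅x⁆ x))

∣p∣≤1⇒p≡⊥∨p≡⁅x⁆ : ∣ p ∣ ≤ 1 → p ≡ ⊥ ⊎ ∃ λ x → p ≡ ⁅ x ⁆
∣p∣≤1⇒p≡⊥∨p≡⁅x⁆ {p = p} ∣p∣≤1 with nonempty? p
... | no p-empty = inj₁ (Empty-unique p-empty)
... | yes (x , x∈p) =
  inj₂ (x , sym (p⊆q∧∣q∣≤∣p∣⇒p≡q (x∈p⇒⁅x⁆⊆p x∈p) (≤-trans ∣p∣≤1 (≤-reflexive (sym (∣⁅x⁆∣≡1 x))))))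

n∸1≤∣p∣⇒p≡⊤∨p≡∁⁅x⁆ : {p : Subset n} → n ∸ 1 ≤ ∣ p ∣ → p ≡ ⊤ ⊎ ∃ λ x → p ≡ ∁ ⁅ x ⁆
n∸1≤∣p∣⇒p≡⊤∨p≡∁⁅x⁆ {p = p} n∸1≤∣p∣ with ⊤ ⊆? p
... | yes ⊤⊆p = inj₁ (⊆-antisym ⊆⊤ ⊤⊆p)
... | no ⊤⊈p with x , _ , x∉p ← p⊈q⇒∃x∈p∧x∉q ⊤⊈p =
  inj₂ (x , p⊆q∧∣q∣≤∣p∣⇒p≡q (x∉p⇒p⊆∁⁅x⁆ x∉p) (≤-trans (≤-reflexive (∣∁⁅x⁆∣≡n∸1 x)) n∸1≤∣p∣))

_⊊_ : Subset n → Subset n → Set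
p ⊊ q = p ⊆ q × q ⊈ p

p⊊q⊆⁅x⁆⇒p⊆⊥ : p ⊊ q → q ⊆ ⁅ x ⁆ → p ⊆ ⊥
p⊊q⊆⁅x⁆⇒p⊆⊥ {p = p} {x = x} (p⊆q , q⊈p) q⊆⁅x⁆ y∈p =
  ⊥-elim (q⊈p (⊆-trans q⊆⁅x⁆ (x∈p⇒⁅x⁆⊆p x∈p)))
  where
  x∈p : x ∈ p
  x∈p = subst (_∈ p) (x∈⁅y⁆⇒x≡y x (q⊆⁅x⁆ (p⊆q y∈p))) y∈p

∁⁅x⁆⊆p⊊q⇒⊤⊆q : ∁ ⁅ x ⁆ ⊆ p → p ⊊ q → ⊤ ⊆ q
∁⁅x⁆⊆p⊊q⇒⊤⊆q {x = x} {q = q} ∁⁅x⁆⊆p (p⊆q , q⊈p) {y} _ with y ≟ x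
... | no y≢x = p⊆q (∁⁅x⁆⊆p (x≢y⇒x∈∁⁅y⁆ y≢x))
... | yes refl =
  decidable-stable (x ∈? q) (λ x∉q → q⊈p (⊆-trans (x∉p⇒p⊆∁⁅x⁆ x∉q) ∁⁅x⁆⊆p))

[<_] : ℕ → Subset n
[<_] {zero}  _       = []
[<_] {suc n} zero    = ⊥
[<_] {suc n} (suc k) = inside ∷ [< k ]

[<]-mono : ∀ {k l} → k ≤ l → [<_] {n} k ⊆ [< l ]
[<]-mono {zero}           _         {()}
[<]-mono {suc n} {zero}   _         x∈⊥ = contradiction x∈⊥ ∉⊥
[<]-mono {suc n} {suc k} (s≤s k≤l) = s⊆s ([<]-mono k≤l)

[<]-total : ∀ k l → [<_] {n} k ⊆ [< l ] ⊎ [<_] {n} l ⊆ [< k ]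
[<]-total k l = Sum.map [<]-mono [<]-mono (≤-total k l)

∣[<k]∣≡k : ∀ {k} → k ≤ n → ∣ [<_] {n} k ∣ ≡ k
∣[<k]∣≡k {zero}  {zero}  _         = refl
∣[<k]∣≡k {suc n} {zero}  _         = ∣⊥∣≡0 (suc n)
∣[<k]∣≡k {suc n} {suc k} (s≤s k≤n) = cong suc (∣[<k]∣≡k k≤n)

[<]-injective : ∀ {k l} → k ≤ n → l ≤ n → [<_] {n} k ≡ [< l ] → k ≡ l
[<]-injective k≤n l≤n e = trans (sym (∣[<k]∣≡k k≤n)) (trans (cong ∣_∣ e) (∣[<k]∣≡k l≤n))

data Tame {n : ℕ} : Subset n → Set where
  empty       : Tame ⊥
  full        : Tame ⊤
  singleton   : ∀ x → Tame ⁅ x ⁆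
  cosingleton : ∀ x → Tame (∁ ⁅ x ⁆)
  segment     : ∀ {k} → 1 < k → k < n ∸ 1 → Tame [< k ]

tame-or-medium : (p : Subset n) → Tame p ⊎ (1 < ∣ p ∣ × ∣ p ∣ < n ∸ 1)
tame-or-medium {n} p with ∣ p ∣ ≤? 1 | n ∸ 1 ≤? ∣ p ∣
... | yes small | _ with ∣p∣≤1⇒p≡⊥∨p≡⁅x⁆ {p = p} small
...   | inj₁ refl       = inj₁ empty
...   | inj₂ (x , refl) = inj₁ (singleton x)
tame-or-medium p | no _ | yes large with n∸1≤∣p∣⇒p≡⊤∨p≡∁⁅x⁆ {p = p} large
...   | inj₁ refl       = inj₁ full
...   | inj₂ (x , refl) = inj₁ (cosingleton x)
tame-or-medium p | no not-small | no not-large = inj₂ (≰⇒> not-small , ≰⇒> not-large)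

record StrictChain₃ (X : Fin 3 → Subset n) : Set where
  constructor strictChain₃
  field
    lower : X bot ⊊ X mid
    upper : X mid ⊊ X top

chain₃ : Subset n → Subset n → Subset n → Fin 3 → Subset n
chain₃ p q r bot = p
chain₃ p q r mid = q
chain₃ p q r top = r

chain₃-∈ : {𝓕 : Family n} → p List.∈ 𝓕 → q List.∈ 𝓕 → r List.∈ 𝓕 → ∀ i → chain₃ p q r i List.∈ 𝓕
chain₃-∈ p∈𝓕 _ _ bot = p∈𝓕
chain₃-∈ _ q∈𝓕 _ mid = q∈𝓕
chain₃-∈ _ _ r∈𝓕 top = r∈𝓕

strictChain₃-order : {X : Fin 3 → Subset n} → StrictChain₃ X → ∀ i j → i F.≤ j ⇔ X i ⊆ X j
strictChain₃-order {X = X} (strictChain₃ (X₀⊆X₁ , X₁⊈X₀) (X₁⊆X₂ , X₂⊈X₁)) i j =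
  mk⇔ (monotone i j) (reflecting i j)
  where
  monotone : ∀ i j → i F.≤ j → X i ⊆ X j
  monotone bot bot _       = ⊆-refl
  monotone bot mid _       = X₀⊆X₁
  monotone bot top _       = ⊆-trans X₀⊆X₁ X₁⊆X₂
  monotone mid mid _       = ⊆-refl
  monotone mid top _       = X₁⊆X₂
  monotone top top _       = ⊆-refl
  monotone mid bot ()
  monotone top bot ()
  monotone top mid (s≤s ())

  reflecting : ∀ i j → X i ⊆ X j → i F.≤ j
  reflecting bot _   _     = z≤n
  reflecting mid mid _     = ≤-refl
  reflecting mid top _     = s≤s z≤n
  reflecting top top _     = ≤-refl
  reflecting mid bot X₁⊆X₀ = ⊥-elim (X₁⊈X₀ X₁⊆X₀)
  reflecting top bot X₂⊆X₀ = ⊥-elim (X₁⊈X₀ (⊆-trans X₁⊆X₂ X₂⊆X₀))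
  reflecting top mid X₂⊆X₁ = ⊥-elim (X₂⊈X₁ X₂⊆X₁)

∈bottom∧∉top⇒⊈ : {X Y : Fin 3 → Subset n} → StrictChain₃ X → StrictChain₃ Y →
  x ∈ X bot → x ∉ Y top → ∀ i j → X i ⊈ Y j
∈bottom∧∉top⇒⊈ X↑ Y↑ x∈X₀ x∉Y₂ i j Xi⊆Yj =
  x∉Y₂ (to (strictChain₃-order Y↑ j top) (≤fromℕ j) (Xi⊆Yj (to (strictChain₃-order X↑ bot i) z≤n x∈X₀)))

≤2C₃-antisym : ∀ {p q} → p ≤2C₃ q → q ≤2C₃ p → p ≡ q
≤2C₃-antisym {c , i} {.c , j} (refl , i≤j) (_ , j≤i) = cong (c ,_) (≤-antisym i≤j j≤i)

orderEmbedding⇒injective : {f : 2C₃ → Subset n} → (∀ p q → p ≤2C₃ q ⇔ f p ⊆ f q) → Injective _≡_ _≡_ f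
orderEmbedding⇒injective order {p} {q} fp≡fq =
  ≤2C₃-antisym (from (order p q) (⊆-reflexive fp≡fq)) (from (order q p) (⊆-reflexive (sym fp≡fq)))

_⊕_ : (Fin 3 → Subset n) → (Fin 3 → Subset n) → 2C₃ → Subset n
(X ⊕ Y) (left  , i) = X i
(X ⊕ Y) (right , i) = Y i

inducedCopy : {𝓕 : Family n} {X Y : Fin 3 → Subset n} {x y : Fin n} →
  StrictChain₃ X → StrictChain₃ Y →
  x ∈ X bot → x ∉ Y top → y ∈ Y bot → y ∉ X top →
  (∀ i → X i List.∈ 𝓕) → (∀ i → Y i List.∈ 𝓕) → InducedCopy2C₃ 𝓕
inducedCopy {𝓕 = 𝓕} {X} {Y} X↑ Y↑ x∈X₀ x∉Y₂ y∈Y₀ y∉X₂ X∈𝓕 Y∈𝓕 =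
  X ⊕ Y , orderEmbedding⇒injective order , members , order
  where
  members : ∀ p → (X ⊕ Y) p List.∈ 𝓕
  members (left  , i) = X∈𝓕 i
  members (right , i) = Y∈𝓕 i

  sameChain : ∀ {c i j} {P : Set} → i F.≤ j ⇔ P → (c , i) ≤2C₃ (c , j) ⇔ P
  sameChain i≤j⇔P = mk⇔ (λ (_ , i≤j) → to i≤j⇔P i≤j) (λ P → refl , from i≤j⇔P P)

  differentChains : ∀ {c d i j} {P : Set} → c ≢ d → ¬ P → (c , i) ≤2C₃ (d , j) ⇔ P
  differentChains c≢d ¬P = mk⇔ (λ (c≡d , _) → contradiction c≡d c≢d) (λ P → contradiction P ¬P)

  order : ∀ p q → p ≤2C₃ q ⇔ (X ⊕ Y) p ⊆ (X ⊕ Y) q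
  order (left  , i) (left  , j) = sameChain (strictChain₃-order X↑ i j)
  order (right , i) (right , j) = sameChain (strictChain₃-order Y↑ i j)
  order (left  , i) (right , j) = differentChains (λ ()) (∈bottom∧∉top⇒⊈ X↑ Y↑ x∈X₀ x∉Y₂ i j)
  order (right , i) (left  , j) = differentChains (λ ()) (∈bottom∧∉top⇒⊈ Y↑ X↑ y∈Y₀ y∉X₂ i j)

tame-middle-is-segment : {p q r : Subset n} → Tame q → p ⊊ q → q ⊊ r → p ⊈ ⊥ → ⊤ ⊈ r →
  ∃ λ k → q ≡ [< k ]
tame-middle-is-segment empty             (p⊆q , _) _         p⊈⊥ _   = ⊥-elim (p⊈⊥ p⊆q)
tame-middle-is-segment full              _         (q⊆r , _) _   ⊤⊈r = ⊥-elim (⊤⊈r q⊆r)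
tame-middle-is-segment (singleton x)     p⊊q       _         p⊈⊥ _   = ⊥-elim (p⊈⊥ (p⊊q⊆⁅x⁆⇒p⊆⊥ p⊊q ⊆-refl))
tame-middle-is-segment (cosingleton x)   _         q⊊r       _   ⊤⊈r = ⊥-elim (⊤⊈r (∁⁅x⁆⊆p⊊q⇒⊤⊆q ⊆-refl q⊊r))
tame-middle-is-segment (segment {k} _ _) _         _         _   _   = k , refl

module InducedCopyOf {𝓕 : Family n} (copy : InducedCopy2C₃ 𝓕) where

  ι : 2C₃ → Subset n
  ι = proj₁ copy

  preserves : ∀ p q → p ≤2C₃ q → ι p ⊆ ι q
  preserves p q = to (proj₂ (proj₂ (proj₂ copy)) p q)

  reflects : ∀ p q → ι p ⊆ ι q → p ≤2C₃ q
  reflects p q = from (proj₂ (proj₂ (proj₂ copy)) p q)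

  chain : ∀ c → StrictChain₃ (λ i → ι (c , i))
  chain c = strictChain₃ (ι-⊊ (s≤s z≤n)) (ι-⊊ (s≤s (s≤s z≤n)))
    where
    ι-⊊ : ∀ {i j} → i F.< j → ι (c , i) ⊊ ι (c , j)
    ι-⊊ {i} {j} i<j =
      preserves (c , i) (c , j) (refl , <⇒≤ i<j) ,
      λ ιj⊆ιi → <⇒≱ i<j (proj₂ (reflects (c , j) (c , i) ιj⊆ιi))

  bottom⊈⊥ : ∀ {c d} → c ≢ d → ι (c , bot) ⊈ ⊥
  bottom⊈⊥ {c} {d} c≢d ιc₀⊆⊥ = c≢d (proj₁ (reflects (c , bot) (d , top) (⊆-trans ιc₀⊆⊥ ⊥⊆)))

  ⊤⊈top : ∀ {c d} → c ≢ d → ⊤ ⊈ ι (c , top)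
  ⊤⊈top {c} {d} c≢d ⊤⊆ιc₂ = c≢d (sym (proj₁ (reflects (d , bot) (c , top) (⊆-trans ⊆⊤ ⊤⊆ιc₂))))

  middles-incomparable : ∀ {c d} → c ≢ d → ι (c , mid) ⊈ ι (d , mid)
  middles-incomparable {c} {d} c≢d ιc₁⊆ιd₁ = c≢d (proj₁ (reflects (c , mid) (d , mid) ιc₁⊆ιd₁))

  middle-is-segment : All Tame 𝓕 → ∀ {c d} → c ≢ d → ∃ λ k → ι (c , mid) ≡ [< k ]
  middle-is-segment 𝓕-tame {c} c≢d =
    tame-middle-is-segment (All.lookup 𝓕-tame (proj₁ (proj₂ (proj₂ copy)) (c , mid)))
      (StrictChain₃.lower (chain c)) (StrictChain₃.upper (chain c)) (bottom⊈⊥ c≢d) (⊤⊈top c≢d)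

  middles-comparable : All Tame 𝓕 → ι (left , mid) ⊆ ι (right , mid) ⊎ ι (right , mid) ⊆ ι (left , mid)
  middles-comparable 𝓕-tame
    with k , ι₀≡[<k] ← middle-is-segment 𝓕-tame {left} {right} (λ ())
       | l , ι₁≡[<l] ← middle-is-segment 𝓕-tame {right} {left} (λ ())
    = subst₂ (λ A B → A ⊆ B ⊎ B ⊆ A) (sym ι₀≡[<k]) (sym ι₁≡[<l]) ([<]-total k l)

tame-noInducedCopy : {𝓕 : Family n} → All Tame 𝓕 → ¬ InducedCopy2C₃ 𝓕
tame-noInducedCopy 𝓕-tame copy =
  Sum.[ middles-incomparable (λ ()) , middles-incomparable (λ ()) ]′ (middles-comparable 𝓕-tame)
  where open InducedCopyOf copy

medium-strictChain₃ : ∀ {n} {p : Subset n} {x y} → 1 < ∣ p ∣ → ∣ p ∣ < n ∸ 1 → x ∈ p → y ∉ p →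
  StrictChain₃ (chain₃ ⁅ x ⁆ p (∁ ⁅ y ⁆))
medium-strictChain₃ {p = p} {x} {y} 1<∣p∣ ∣p∣<n∸1 x∈p y∉p = strictChain₃
  (x∈p⇒⁅x⁆⊆p x∈p , ∣p∣<∣q∣⇒q⊈p (subst (_< ∣ p ∣) (sym (∣⁅x⁆∣≡1 x)) 1<∣p∣))
  (x∉p⇒p⊆∁⁅x⁆ y∉p , ∣p∣<∣q∣⇒q⊈p (subst (∣ p ∣ <_) (sym (∣∁⁅x⁆∣≡n∸1 y)) ∣p∣<n∸1))

equalSize-inducedCopy : ∀ {n} {𝓕 : Family n} {p q : Subset n} →
  1 < ∣ q ∣ → ∣ q ∣ < n ∸ 1 → ∣ p ∣ ≡ ∣ q ∣ → p ≢ q →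
  (∀ x → ⁅ x ⁆ List.∈ 𝓕) → (∀ x → ∁ ⁅ x ⁆ List.∈ 𝓕) → p List.∈ 𝓕 → q List.∈ 𝓕 →
  InducedCopy2C₃ 𝓕
equalSize-inducedCopy 1<∣q∣ ∣q∣<n∸1 ∣p∣≡∣q∣ p≢q ⁅⁆∈𝓕 ∁⁅⁆∈𝓕 p∈𝓕 q∈𝓕
  with a , a∈p , a∉q ← p⊈q⇒∃x∈p∧x∉q (∣p∣≡∣q∣∧p≢q⇒p⊈q ∣p∣≡∣q∣ p≢q)
     | b , b∈q , b∉p ← p⊈q⇒∃x∈p∧x∉q (∣p∣≡∣q∣∧p≢q⇒p⊈q (sym ∣p∣≡∣q∣) (p≢q ∘ sym))
  = inducedCopy
      (medium-strictChain₃ (subst (1 <_) (sym ∣p∣≡∣q∣) 1<∣q∣) (subst (_< _) (sym ∣p∣≡∣q∣) ∣q∣<n∸1) a∈p b∉p)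
      (medium-strictChain₃ 1<∣q∣ ∣q∣<n∸1 b∈q a∉q)
      (x∈⁅x⁆ a) (x∈p⇒x∉∁p (x∈⁅x⁆ a)) (x∈⁅x⁆ b) (x∈p⇒x∉∁p (x∈⁅x⁆ b))
      (chain₃-∈ (⁅⁆∈𝓕 a) p∈𝓕 (∁⁅⁆∈𝓕 b)) (chain₃-∈ (⁅⁆∈𝓕 b) q∈𝓕 (∁⁅⁆∈𝓕 a))

tame-saturating : {𝓕 : Family n} → (∀ {p} → Tame p → p List.∈ 𝓕) →
  ∀ G → G List.∉ 𝓕 → InducedCopy2C₃ (G ∷ 𝓕)
tame-saturating complete G G∉𝓕 with tame-or-medium G
... | inj₁ G-tame = contradiction (complete G-tame) G∉𝓕
... | inj₂ (1<∣G∣ , ∣G∣<n∸1) =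
  equalSize-inducedCopy 1<∣G∣ ∣G∣<n∸1 (∣[<k]∣≡k (∣p∣≤n G)) [<∣G∣]≢G
    (there ∘ complete ∘ singleton) (there ∘ complete ∘ cosingleton)
    (there (complete [<∣G∣]-tame)) (here refl)
  where
  [<∣G∣]-tame : Tame [< ∣ G ∣ ]
  [<∣G∣]-tame = segment 1<∣G∣ ∣G∣<n∸1

  [<∣G∣]≢G : [< ∣ G ∣ ] ≢ G
  [<∣G∣]≢G [<∣G∣]≡G = G∉𝓕 (subst (List._∈ _) [<∣G∣]≡G (complete [<∣G∣]-tame))

record SizeIn (l u : ℕ) (p : Subset n) : Set where
  constructor sizeIn
  field
    lower : l ≤ ∣ p ∣
    upper : ∣ p ∣ < u

∣p∣≡s⇒sizeIn : ∀ {l s u} → ∣ p ∣ ≡ s → l ≤ s → s < u → SizeIn l u p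
∣p∣≡s⇒sizeIn refl l≤s s<u = sizeIn l≤s s<u

UniqueAbove : ℕ → Family n → Set
UniqueAbove l 𝓕 = Unique 𝓕 × All (λ p → l ≤ ∣ p ∣) 𝓕

uniqueAbove-++ : ∀ {l b} {𝓖 𝓗 : Family n} → l ≤ b → Unique 𝓖 → All (SizeIn l b) 𝓖 →
  UniqueAbove b 𝓗 → UniqueAbove l (𝓖 ++ 𝓗)
uniqueAbove-++ l≤b 𝓖! 𝓖-sizes (𝓗! , 𝓗-sizes) =
  Unique.++⁺ 𝓖! 𝓗! (λ (p∈𝓖 , p∈𝓗) → <⇒≱ (SizeIn.upper (All.lookup 𝓖-sizes p∈𝓖)) (All.lookup 𝓗-sizes p∈𝓗)) ,
  All.++⁺ (All.map SizeIn.lower 𝓖-sizes) (All.map (≤-trans l≤b) 𝓗-sizes)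

singletons : ∀ n → Family n
singletons n = map ⁅_⁆ (allFin n)

cosingletons : ∀ n → Family n
cosingletons n = map (∁ ∘ ⁅_⁆) (allFin n)

medianSegments : ∀ m → Family (3 + m)
medianSegments m = applyUpTo (λ j → [< 2 + j ]) m

tameSets : ∀ m → Family (3 + m)
tameSets m = ⊥ ∷ singletons _ ++ medianSegments m ++ cosingletons _ ++ ⊤ ∷ []

module _ (m : ℕ) where

  j<m⇒2+j≤3+m : ∀ {j} → j < m → 2 + j ≤ 3 + m
  j<m⇒2+j≤3+m j<m = s≤s (s≤s (m≤n⇒m≤1+n (<⇒≤ j<m)))

  tameSets-tame : All Tame (tameSets m)
  tameSets-tame = empty ∷
    All.++⁺ (All.map⁺ (All.tabulate⁺ {f = id} singleton))
    (All.++⁺ (All.applyUpTo⁺₁ _ m (λ j<m → segment (s≤s (s≤s z≤n)) (s≤s (s≤s j<m))))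
    (All.++⁺ (All.map⁺ (All.tabulate⁺ {f = id} cosingleton))
    (full ∷ [])))

  tameSets-complete : ∀ {p} → Tame p → p List.∈ tameSets m
  tameSets-complete empty = here refl
  tameSets-complete (singleton x) = there (∈-++⁺ˡ (∈-map⁺ ⁅_⁆ (∈-allFin x)))
  tameSets-complete (segment {suc (suc j)} (s≤s (s≤s z≤n)) (s≤s (s≤s j<m))) =
    there (∈-++⁺ʳ (singletons _) (∈-++⁺ˡ (∈-applyUpTo⁺ (λ j → [< 2 + j ]) j<m)))
  tameSets-complete (cosingleton x) =
    there (∈-++⁺ʳ (singletons _) (∈-++⁺ʳ (medianSegments m) (∈-++⁺ˡ (∈-map⁺ (∁ ∘ ⁅_⁆) (∈-allFin x)))))
  tameSets-complete full =
    there (∈-++⁺ʳ (singletons _) (∈-++⁺ʳ (medianSegments m) (∈-++⁺ʳ (cosingletons _) (here refl))))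

  -- The blocks of tameSets have sizes 0, 1, [2, m+1], m+2 and m+3 in turn.
  tameSets-unique : Unique (tameSets m)
  tameSets-unique = proj₁
    (uniqueAbove-++ z≤n ([] ∷ []) (∣p∣≡s⇒sizeIn (∣⊥∣≡0 (3 + m)) ≤-refl ≤-refl ∷ [])
    (uniqueAbove-++ (s≤s z≤n) (Unique.map⁺ ⁅⁆-injective (Unique.allFin⁺ _))
      (All.map⁺ (All.tabulate⁺ {f = id} λ x → ∣p∣≡s⇒sizeIn (∣⁅x⁆∣≡1 x) ≤-refl ≤-refl))
    (uniqueAbove-++ (s≤s (s≤s z≤n)) segments-unique segments-sizes
    (uniqueAbove-++ (n≤1+n _) (Unique.map⁺ ∁⁅⁆-injective (Unique.allFin⁺ _))
      (All.map⁺ (All.tabulate⁺ {f = id} λ x → ∣p∣≡s⇒sizeIn (∣∁⁅x⁆∣≡n∸1 x) ≤-refl ≤-refl))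
    (([] ∷ []) , (≤-reflexive (sym (∣⊤∣≡n _)) ∷ []))))))
    where
    ∣[<2+j]∣ : ∀ {j} → j < m → ∣ [<_] {3 + m} (2 + j) ∣ ≡ 2 + j
    ∣[<2+j]∣ j<m = ∣[<k]∣≡k (j<m⇒2+j≤3+m j<m)

    segments-sizes : All (SizeIn 2 (2 + m)) (medianSegments m)
    segments-sizes = All.applyUpTo⁺₁ _ m λ j<m →
      ∣p∣≡s⇒sizeIn (∣[<2+j]∣ j<m) (s≤s (s≤s z≤n)) (s≤s (s≤s j<m))

    segments-unique : Unique (medianSegments m)
    segments-unique = Unique.applyUpTo⁺₁ _ m λ i<j j<m [<2+i]≡[<2+j] →
      <⇒≢ (s≤s (s≤s i<j))
        ([<]-injective (j<m⇒2+j≤3+m (<-trans i<j j<m)) (j<m⇒2+j≤3+m j<m) [<2+i]≡[<2+j])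

  tameSets-length : length (tameSets m) ≡ 3 * (3 + m) ∸ 1
  tameSets-length = begin
    length (tameSets m)
      ≡⟨ cong suc (trans (length-++ (singletons (3 + m))) (cong₂ _+_ (length-allFin-map ⁅_⁆)
           (trans (length-++ (medianSegments m)) (cong₂ _+_ (length-applyUpTo _ m)
             (trans (length-++ (cosingletons (3 + m))) (cong (_+ 1) (length-allFin-map (∁ ∘ ⁅_⁆)))))))) ⟩
    suc ((3 + m) + (m + ((3 + m) + 1)))
      ≡⟨ cong (_∸ 1) (counting m) ⟩
    3 * (3 + m) ∸ 1 ∎
    where
    open ≡-Reasoning
    counting : ∀ m → 2 + ((3 + m) + (m + ((3 + m) + 1))) ≡ 3 * (3 + m)
    counting = solve-∀
    length-allFin-map : (f : Fin (3 + m) → Subset (3 + m)) → length (map f (allFin (3 + m))) ≡ 3 + m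
    length-allFin-map f = trans (length-map f (allFin (3 + m))) (length-tabulate id)

tameFamily : ∀ n → 1 ≤ n →
  Σ[ 𝓕 ∈ Family n ] (Unique 𝓕 × All Tame 𝓕 × (∀ {p} → Tame p → p List.∈ 𝓕) × length 𝓕 ≤ 3 * n ∸ 1)
tameFamily 1 _ = ⊥ ∷ ⊤ ∷ [] , ((λ ()) ∷ []) ∷ [] ∷ [] , empty ∷ full ∷ [] , (λ {p} _ → every p) , ≤-refl
  where
  every : ∀ p → p List.∈ ⊥ ∷ ⊤ ∷ []
  every (outside ∷ []) = here refl
  every (inside  ∷ []) = there (here refl)
tameFamily 2 _ =
  ⊥ ∷ ⊤ ∷ ⁅ zero ⁆ ∷ ⁅ suc zero ⁆ ∷ [] ,
  ((λ ()) ∷ (λ ()) ∷ (λ ()) ∷ []) ∷ ((λ ()) ∷ (λ ()) ∷ []) ∷ ((λ ()) ∷ []) ∷ [] ∷ [] ,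
  empty ∷ full ∷ singleton zero ∷ singleton (suc zero) ∷ [] , (λ {p} _ → every p) , n≤1+n 4
  where
  every : ∀ p → p List.∈ ⊥ ∷ ⊤ ∷ ⁅ zero ⁆ ∷ ⁅ suc zero ⁆ ∷ []
  every (outside ∷ outside ∷ []) = here refl
  every (inside  ∷ inside  ∷ []) = there (here refl)
  every (inside  ∷ outside ∷ []) = there (there (here refl))
  every (outside ∷ inside  ∷ []) = there (there (there (here refl)))
tameFamily (suc (suc (suc m))) _ =
  tameSets m , tameSets-unique m , tameSets-tame m , tameSets-complete m , ≤-reflexive (tameSets-length m)

proposition28 : (n : ℕ) → 1 ≤ n →
    Σ[ 𝓕 ∈ List (Subset n) ]
      (Unique 𝓕 × InducedSaturating2C₃ 𝓕 × length 𝓕 ≤ 3 * n ∸ 1)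
proposition28 n 1≤n =
  let 𝓕 , 𝓕-unique , 𝓕-tame , 𝓕-complete , 𝓕-length = tameFamily n 1≤n
  in 𝓕 , 𝓕-unique , (tame-noInducedCopy 𝓕-tame , tame-saturating 𝓕-complete) , 𝓕-length
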